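{- There exists an even $\Delta$-matroid of arity $6$ which is not matching realizable.
   Context: A nonempty $M\subseteq\{0,1\}^n$ is a $\Delta$-matroid if for all $\alpha,\beta\in M$ and each coordinate $v$ where $\alpha,\beta$ differ, there is a coordinate $u$ where they differ such that the tuple obtained from $\alpha$ by flipping coordinates $u$ and $v$ (only $v$ if $u=v$) lies in $M$; it is even if all tuples in $M$ have the same parity of the number of ones. Let $G$ be a finite graph and $v_1,\dots,v_a$ distinct vertices of $G$. For $T=(x_1,\dots,x_a)\in\{0,1\}^a$ let $G_T$ be obtained from $G$ by deleting all $v_i$ with $x_i=1$, and let $M(G,v_1,\dots,v_a)=\{T\in\{0,1\}^a: G_T$ has a perfect matching$\}$. A relation $R\subseteq\{0,1\}^a$ is matching realizable if $R=M(G,v_1,\dots,v_a)$ for some graph $G$ and distinct vertices $v_1,\dots,v_a$. -}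

module Defs where

open import Data.Bool using (Bool; true; false; not; if_then_else_)
open import Data.Nat using (ℕ; zero; suc; _%_)
open import Data.Fin using (Fin; _≟_)
open import Data.Vec using (Vec; []; _∷_; lookup; _[_]%=_)
open import Data.Product using (Σ; ∃; _×_; _,_)
open import Relation.Nullary using (¬_; does)
open import Relation.Binary.PropositionalEquality using (_≡_; _≢_)
open import Function.Definitions using (Injective)
open import Function.Bundles using (_⇔_)

-- Boolean tuples {0,1}^n are  Vec Bool n  (false = 0, true = 1).
-- A relation of arity n is a predicate on such tuples.
Relation : ℕ → Set₁
Relation n = Vec Bool n → Set

ones : ∀ {n} → Vec Bool n → ℕ
ones []            = 0
ones (true  ∷ xs) = suc (ones xs)
ones (false ∷ xs) = ones xs

flip1 : ∀ {n} → Vec Bool n → Fin n → Vec Bool n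
flip1 α v = α [ v ]%= not

flip2 : ∀ {n} → Vec Bool n → Fin n → Fin n → Vec Bool n
flip2 α u v = if does (u ≟ v) then flip1 α v else flip1 (flip1 α u) v

Nonempty : ∀ {n} → Relation n → Set
Nonempty M = ∃ λ α → M α

IsDeltaMatroid : ∀ {n} → Relation n → Set
IsDeltaMatroid {n} M =
  Nonempty M ×
  (∀ α β → M α → M β → (v : Fin n) → lookup α v ≢ lookup β v →
     Σ (Fin n) λ u → lookup α u ≢ lookup β u × M (flip2 α u v))

IsEven : ∀ {n} → Relation n → Set
IsEven M = ∀ α β → M α → M β → ones α % 2 ≡ ones β % 2

IsEvenDeltaMatroid : ∀ {n} → Relation n → Set
IsEvenDeltaMatroid M = IsDeltaMatroid M × IsEven M

record Graph : Set where
  field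
    size  : ℕ
    adj   : Fin size → Fin size → Bool
    symm  : ∀ x y → adj x y ≡ adj y x
    irrefl : ∀ x → adj x x ≡ false
open Graph public

-- A perfect matching of the induced subgraph G[S] on vertex set S,
-- given as its partner map: each vertex w of S is matched to a unique
-- neighbour μ w in S, and μ (μ w) = w.
HasPerfectMatchingOn : (G : Graph) → (Fin (size G) → Set) → Set
HasPerfectMatchingOn G S =
  Σ (Fin (size G) → Fin (size G)) λ μ →
    ∀ w → S w → S (μ w) × adj G w (μ w) ≡ true × μ w ≢ w × μ (μ w) ≡ w

Remaining : (G : Graph) {a : ℕ} → (Fin a → Fin (size G)) → Vec Bool a → Fin (size G) → Set
Remaining G vs T w = ∀ i → vs i ≡ w → lookup T i ≡ false

MatchRel : (G : Graph) {a : ℕ} → (Fin a → Fin (size G)) → Relation a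
MatchRel G vs T = HasPerfectMatchingOn G (Remaining G vs T)

MatchingRealizable : ∀ {a} → Relation a → Set
MatchingRealizable {a} R =
  Σ Graph λ G → Σ (Fin a → Fin (size G)) λ vs →
    Injective _≡_ _≡_ vs × (∀ T → R T ⇔ MatchRel G vs T)

-- Let μ be a perfect matching of G and ν one of G minus all terminals, extended
-- by fixing the terminals.  Then ν ∘ μ is a permutation whose orbit through a
-- terminal is an alternating path, reversed by ν, joining it to a second
-- terminal.  Every Boolean combination S of the vertex sets of such paths is
-- invariant under μ and ν, so matching by ν inside S and by μ outside is a
-- perfect matching of G minus the terminals in S.  Hence if R = M(G, v), then
-- with j₁, j₂ the partners of terminals 0 and 1, every Boolean combination of
-- {0, j₁} and {1, j₂} lies in R; for the R below a finite search rules out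
-- every choice of j₁, j₂ (and confirms that R is an even Δ-matroid).
module Submission where

open import Defs
open import Data.Bool using (Bool; true; false; if_then_else_)
open import Data.Bool.Properties using () renaming (_≟_ to _≟ᵇ_)
open import Data.Nat using (ℕ; zero; suc; _+_; _∸_; _%_; _<_; _≤_; s≤s; z≤n; ⌊_/2⌋; ⌈_/2⌉)
open import Data.Nat.Properties
  using (n<1+n; +-suc; m∸n≤m; m≤n⇒m<n∨m≡n; m+[n∸m]≡n; m+n∸m≡n; m+n∸n≡m; m<n⇒0<n∸m;
         <⇒≤; ≤-<-trans; <-cmp; ⌊n/2⌋+⌈n/2⌉≡n; ⌊n/2⌋<n; n≡⌊n+n/2⌋; anyUpTo?)
  renaming (_≟_ to _≟ℕ_)
open import Data.Nat.GeneralisedArithmetic using (fold; fold-+; iterate-is-fold)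
open import Data.Fin using (Fin; zero; suc; toℕ; fromℕ<)
open import Data.Fin.Properties
  using (all?; any?; _≟_; pigeonhole; ¬∀⟶∃¬-smallest; toℕ-inject; toℕ-fromℕ<; toℕ<n)
open import Data.Fin.Subset.Properties using (anySubset?)
open import Data.Vec using (Vec; []; _∷_; lookup; tabulate; replicate)
open import Data.Vec.Properties using (≡-dec; lookup∘tabulate; lookup-replicate; tabulate-cong)
open import Data.List using (List; []; _∷_)
open import Data.List.Membership.Propositional using (_∈_)
open import Data.List.Membership.DecPropositional (≡-dec {n = 6} _≟ᵇ_) using (_∈?_)
open import Data.List.Relation.Unary.All as All using (All)
open import Data.Product using (Σ; ∃; ∃₂; _×_; _,_; proj₁; proj₂)
open import Data.Sum using (_⊎_; inj₁; inj₂)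
open import Function using (_∘_; _⇔_; mk⇔; case_of_; Equivalence)
open import Function.Definitions using (Injective)
open import Function.Consequences.Propositional using (inverseʳ⇒injective; strictlyInverseʳ⇒inverseʳ)
open import Relation.Binary using (tri<; tri≈; tri>)
open import Relation.Binary.PropositionalEquality
  using (_≡_; _≢_; refl; sym; trans; cong; cong₂; subst; module ≡-Reasoning)
open import Relation.Nullary using (¬_; Dec; yes; no; does; ¬?; contradiction)
open import Relation.Nullary.Decidable
  using (_×-dec_; _→-dec_; _⊎-dec_; does-⇔; decidable-stable; toWitness)
open import Relation.Unary using (Decidable)

open ≡-Reasoning

fold-suc : ∀ {A : Set} (z : A) (s : A → A) k → fold z s (suc k) ≡ fold (s z) s k
fold-suc z s k = trans (iterate-is-fold z s (suc k)) (sym (iterate-is-fold (s z) s k))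

⌈n/2⌉≡⌊n/2⌋⊎1+⌊n/2⌋ : ∀ n → ⌈ n /2⌉ ≡ ⌊ n /2⌋ ⊎ ⌈ n /2⌉ ≡ suc ⌊ n /2⌋
⌈n/2⌉≡⌊n/2⌋⊎1+⌊n/2⌋ zero          = inj₁ refl
⌈n/2⌉≡⌊n/2⌋⊎1+⌊n/2⌋ (suc zero)    = inj₂ refl
⌈n/2⌉≡⌊n/2⌋⊎1+⌊n/2⌋ (suc (suc n)) with ⌈n/2⌉≡⌊n/2⌋⊎1+⌊n/2⌋ n
... | inj₁ e = inj₁ (cong suc e)
... | inj₂ e = inj₂ (cong suc e)

involutive⇒injective : ∀ {A : Set} (f : A → A) → (∀ x → f (f x) ≡ x) → Injective _≡_ _≡_ f
involutive⇒injective f f-involutive =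
  inverseʳ⇒injective f (strictlyInverseʳ⇒inverseʳ {f⁻¹ = f} f f-involutive)

module _ {n} {f : Fin n → Fin n} (f-injective : Injective _≡_ _≡_ f) where

  fold-injective : ∀ k → Injective _≡_ _≡_ (λ x → fold x f k)
  fold-injective zero    e = e
  fold-injective (suc k) e = fold-injective k (f-injective e)

  fold-cancelˡ : ∀ x k d → fold x f k ≡ fold x f (k + d) → fold x f d ≡ x
  fold-cancelˡ x k d e = sym (fold-injective k (trans e (fold-+ x f k)))

  fold-returns : ∀ x → ∃ λ (d : Fin (suc n)) → fold x f (suc (toℕ d)) ≡ x
  fold-returns x with pigeonhole (n<1+n n) (λ (k : Fin (suc n)) → fold x f (toℕ k))
  ... | i , j , i<j , e =
    fromℕ< d<1+n , subst (λ m → fold x f (suc m) ≡ x) (sym (toℕ-fromℕ< d<1+n)) x-returns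
    where
    d : ℕ
    d = toℕ j ∸ suc (toℕ i)
    d<1+n : d < suc n
    d<1+n = ≤-<-trans (m∸n≤m (toℕ j) (suc (toℕ i))) (toℕ<n j)
    x-returns : fold x f (suc d) ≡ x
    x-returns = fold-cancelˡ x (toℕ i) (suc d)
      (trans e (cong (fold x f) (sym (trans (+-suc (toℕ i) d) (m+[n∸m]≡n i<j)))))

  minimalPeriod : ∀ x → ∃ λ q → fold x f (suc q) ≡ x × (∀ {m} → m < q → fold x f (suc m) ≢ x)
  minimalPeriod x with ¬∀⟶∃¬-smallest (suc n) (λ d → fold x f (suc (toℕ d)) ≢ x)
                         (λ d → ¬? (fold x f (suc (toℕ d)) ≟ x))
                         (λ never → let d , ret = fold-returns x in never d ret)
  ... | d , ¬¬ret , earlier = toℕ d , decidable-stable (fold x f (suc (toℕ d)) ≟ x) ¬¬ret , minimal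
    where
    minimal : ∀ {m} → m < toℕ d → fold x f (suc m) ≢ x
    minimal m<d = subst (λ m → fold x f (suc m) ≢ x) (trans (toℕ-inject _) (toℕ-fromℕ< m<d))
                    (earlier (fromℕ< m<d))

  periodicOrbit : ∀ x → ∃ λ q → fold x f (suc q) ≡ x ×
                    (∀ {k l} → k < suc q → l < suc q → fold x f k ≡ fold x f l → k ≡ l)
  periodicOrbit x with minimalPeriod x
  ... | q , period , minimal = q , period , orbit-injective
    where
    no-return : ∀ {d} → 0 < d → d < suc q → fold x f d ≢ x
    no-return {suc d} _ (s≤s d<q) = minimal d<q

    distinct : ∀ {k l} → k < l → l < suc q → fold x f k ≢ fold x f l
    distinct {k} {l} k<l l<1+q e = no-return (m<n⇒0<n∸m k<l) (≤-<-trans (m∸n≤m l k) l<1+q)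
      (fold-cancelˡ x k (l ∸ k) (trans e (cong (fold x f) (sym (m+[n∸m]≡n (<⇒≤ k<l))))))

    orbit-injective : ∀ {k l} → k < suc q → l < suc q → fold x f k ≡ fold x f l → k ≡ l
    orbit-injective {k} {l} k<1+q l<1+q e with <-cmp k l
    ... | tri< k<l _ _ = contradiction e (distinct k<l l<1+q)
    ... | tri≈ _ k≡l _ = k≡l
    ... | tri> _ _ l<k = contradiction (sym e) (distinct l<k k<1+q)

does-invariant : ∀ {A : Set} {P : A → Set} (P? : Decidable P) {f : A → A} →
  (∀ x → f (f x) ≡ x) → (∀ {x} → P x → P (f x)) → ∀ x → does (P? (f x)) ≡ does (P? x)
does-invariant {P = P} P? {f} f-involutive P-preserved x =
  does-⇔ (mk⇔ (subst P (f-involutive x) ∘ P-preserved) P-preserved) (P? (f x)) (P? x)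

inPair : ∀ {a} → Fin a → Fin a → Fin a → Bool
inPair i j k = does ((k ≟ i) ⊎-dec (k ≟ j))

module AlternatingPaths (G : Graph) {a} (vs : Fin a → Fin (size G)) (vs-injective : Injective _≡_ _≡_ vs)
  (M₀ : MatchRel G vs (replicate a false)) (M₁ : MatchRel G vs (replicate a true)) where

  V : Set
  V = Fin (size G)

  Terminal : V → Set
  Terminal w = ∃ λ i → vs i ≡ w

  terminal? : Decidable Terminal
  terminal? w = any? λ i → vs i ≟ w

  μ : V → V
  μ = proj₁ M₀

  μ-partner : ∀ w → adj G w (μ w) ≡ true × μ w ≢ w × μ (μ w) ≡ w
  μ-partner w = proj₂ (proj₂ M₀ w λ i _ → lookup-replicate i false)

  μ-involutive : ∀ w → μ (μ w) ≡ w
  μ-involutive w = proj₂ (proj₂ (μ-partner w))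

  ν : V → V
  ν = proj₁ M₁

  ν-partner : ∀ {w} → ¬ Terminal w →
    ¬ Terminal (ν w) × adj G w (ν w) ≡ true × ν w ≢ w × ν (ν w) ≡ w
  ν-partner {w} w∉ with proj₂ M₁ w (λ i vsi≡w → contradiction (i , vsi≡w) w∉)
  ... | νw-remains , rest = νw∉ , rest
    where
    νw∉ : ¬ Terminal (ν w)
    νw∉ (i , vsi≡νw) = contradiction (trans (sym (lookup-replicate i true)) (νw-remains i vsi≡νw)) λ ()

  ν̂ : V → V
  ν̂ w with terminal? w
  ... | yes _ = w
  ... | no  _ = ν w

  ν̂-terminal : ∀ {w} → Terminal w → ν̂ w ≡ w
  ν̂-terminal {w} w∈ with terminal? w
  ... | yes _  = refl
  ... | no w∉ = contradiction w∈ w∉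

  ν̂-nonterminal : ∀ {w} → ¬ Terminal w → ν̂ w ≡ ν w
  ν̂-nonterminal {w} w∉ with terminal? w
  ... | yes w∈ = contradiction w∈ w∉
  ... | no _   = refl

  ν̂-involutive : ∀ w → ν̂ (ν̂ w) ≡ w
  ν̂-involutive w = case terminal? w of λ where
    (yes w∈) → trans (cong ν̂ (ν̂-terminal w∈)) (ν̂-terminal w∈)
    (no w∉)  → let νw∉ , _ , _ , νν = ν-partner w∉
               in trans (cong ν̂ (ν̂-nonterminal w∉)) (trans (ν̂-nonterminal νw∉) νν)

  ν̂-partner : ∀ {w} → ¬ Terminal w → ¬ Terminal (ν̂ w) × adj G w (ν̂ w) ≡ true × ν̂ w ≢ w
  ν̂-partner w∉ rewrite ν̂-nonterminal w∉ =
    let νw∉ , ν-adj , ν-moves , _ = ν-partner w∉ in νw∉ , ν-adj , ν-moves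

  ν̂-fixed⇒terminal : ∀ {w} → ν̂ w ≡ w → Terminal w
  ν̂-fixed⇒terminal {w} ν̂w≡w with terminal? w
  ... | yes w∈ = w∈
  ... | no w∉  = contradiction ν̂w≡w (proj₁ (proj₂ (proj₂ (ν-partner w∉))))

  Closed : (V → Bool) → Set
  Closed S = (∀ w → S (μ w) ≡ S w) × (∀ w → S (ν̂ w) ≡ S w)

  closed-combine : ∀ (g : Bool → Bool → Bool) {S T} → Closed S → Closed T → Closed (λ w → g (S w) (T w))
  closed-combine g (μS , ν̂S) (μT , ν̂T) =
    (λ w → cong₂ g (μS w) (μT w)) , (λ w → cong₂ g (ν̂S w) (ν̂T w))

  trace : (V → Bool) → Vec Bool a
  trace S = tabulate (S ∘ vs)

  module _ (S : V → Bool) where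

    remaining-trace : ∀ {u} → (Terminal u → S u ≡ false) → Remaining G vs (trace S) u
    remaining-trace terminal-outside i refl = trans (lookup∘tabulate (S ∘ vs) i) (terminal-outside (i , refl))

    trace-remaining : ∀ {u} → Remaining G vs (trace S) u → Terminal u → S u ≡ false
    trace-remaining u-remains (i , refl) = trans (sym (lookup∘tabulate (S ∘ vs) i)) (u-remains i refl)

  closed⇒matched : ∀ {S} → Closed S → MatchRel G vs (trace S)
  closed⇒matched {S} (μS , ν̂S) = partner , λ w w-remains →
    let remains , adjacent , moves = partner-edge w w-remains in remains , adjacent , moves , partner-involutive w
    where
    partner : V → V
    partner w = if S w then ν̂ w else μ w

    S-partner : ∀ w → S (partner w) ≡ S w
    S-partner w with S w in Sw
    ... | true  = trans (ν̂S w) Sw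
    ... | false = trans (μS w) Sw

    partner-involutive : ∀ w → partner (partner w) ≡ w
    partner-involutive w with S w in Sw
    ... | true  = trans (cong (if_then ν̂ (ν̂ w) else μ (ν̂ w)) (trans (ν̂S w) Sw)) (ν̂-involutive w)
    ... | false = trans (cong (if_then ν̂ (μ w) else μ (μ w)) (trans (μS w) Sw)) (μ-involutive w)

    partner-edge : ∀ w → Remaining G vs (trace S) w →
      Remaining G vs (trace S) (partner w) × adj G w (partner w) ≡ true × partner w ≢ w
    partner-edge w w-remains with S w in Sw
    ... | false = let μ-adj , μ-moves , _ = μ-partner w
                  in remaining-trace S (λ _ → trans (μS w) Sw) , μ-adj , μ-moves
    ... | true  = let ν̂w∉ , ν̂-adj , ν̂-moves = ν̂-partner w∉
                  in remaining-trace S (λ ν̂w∈ → contradiction ν̂w∈ ν̂w∉) , ν̂-adj , ν̂-moves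
      where
      w∉ : ¬ Terminal w
      w∉ w∈ = contradiction (trans (sym Sw) (trace-remaining S w-remains w∈)) λ ()

  step : V → V
  step = ν̂ ∘ μ

  step-injective : Injective _≡_ _≡_ step
  step-injective = involutive⇒injective μ μ-involutive ∘ involutive⇒injective ν̂ ν̂-involutive

  step-ν̂-step : ∀ w → step (ν̂ (step w)) ≡ ν̂ w
  step-ν̂-step w = trans (cong step (ν̂-involutive (μ w))) (cong ν̂ (μ-involutive w))

  ν̂-reverses : ∀ k w → fold (ν̂ (fold w step k)) step k ≡ ν̂ w
  ν̂-reverses zero    w = refl
  ν̂-reverses (suc k) w = begin
    fold (ν̂ (step (fold w step k))) step (suc k)   ≡⟨ fold-suc _ step k ⟩
    fold (step (ν̂ (step (fold w step k)))) step k  ≡⟨ cong (λ z → fold z step k) (step-ν̂-step _) ⟩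
    fold (ν̂ (fold w step k)) step k                ≡⟨ ν̂-reverses k w ⟩
    ν̂ w                                           ∎

  module PathFrom (i₀ : Fin a) where

    x : V
    x = vs i₀

    q : ℕ
    q = proj₁ (periodicOrbit step-injective x)

    p : ℕ
    p = suc q

    period : fold x step p ≡ x
    period = proj₁ (proj₂ (periodicOrbit step-injective x))

    orbit-injective : ∀ {k l} → k < p → l < p → fold x step k ≡ fold x step l → k ≡ l
    orbit-injective = proj₂ (proj₂ (periodicOrbit step-injective x))

    ν̂-orbit : ∀ {k} → k ≤ p → ν̂ (fold x step k) ≡ fold x step (p ∸ k)
    ν̂-orbit {k} k≤p = fold-injective step-injective k (begin
      fold (ν̂ (fold x step k)) step k    ≡⟨ ν̂-reverses k x ⟩
      ν̂ x                                ≡⟨ ν̂-terminal (i₀ , refl) ⟩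
      x                                   ≡⟨ sym period ⟩
      fold x step p                       ≡⟨ cong (fold x step) (sym (m+[n∸m]≡n k≤p)) ⟩
      fold x step (k + (p ∸ k))           ≡⟨ fold-+ x step k ⟩
      fold (fold x step (p ∸ k)) step k   ∎)

    μ-orbit : ∀ {k} → k < p → μ (fold x step k) ≡ fold x step (p ∸ suc k)
    μ-orbit k<p = trans (sym (ν̂-involutive _)) (ν̂-orbit k<p)

    OnPath : V → Set
    OnPath w = ∃ λ k → k < p × fold x step k ≡ w

    onPath? : Decidable OnPath
    onPath? w = anyUpTo? (λ k → fold x step k ≟ w) p

    onPath-≤ : ∀ {k} → k ≤ p → OnPath (fold x step k)
    onPath-≤ {k} k≤p with m≤n⇒m<n∨m≡n k≤p
    ... | inj₁ k<p  = k , k<p , refl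
    ... | inj₂ refl = 0 , s≤s z≤n , sym period

    onPath : V → Bool
    onPath w = does (onPath? w)

    onPath-closed : Closed onPath
    onPath-closed =
      does-invariant onPath? μ-involutive
        (λ { (k , k<p , refl) → subst OnPath (sym (μ-orbit k<p)) (onPath-≤ (m∸n≤m p (suc k))) }) ,
      does-invariant onPath? ν̂-involutive
        (λ { (k , k<p , refl) → subst OnPath (sym (ν̂-orbit (<⇒≤ k<p))) (onPath-≤ (m∸n≤m p k)) })

    half : ℕ
    half = ⌊ p /2⌋

    half<p : half < p
    half<p = ⌊n/2⌋<n q

    midpoint : V
    midpoint = fold x step half

    -- ν̂ reflects the orbit (k ↦ p ∸ k); were p odd, μ would fix the midpoint.
    midpoint-fixed : ν̂ midpoint ≡ midpoint
    midpoint-fixed with ⌈n/2⌉≡⌊n/2⌋⊎1+⌊n/2⌋ p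
    ... | inj₁ even = trans (ν̂-orbit (<⇒≤ half<p)) (cong (fold x step) (trans p∸half even))
      where
      p∸half : p ∸ half ≡ ⌈ p /2⌉
      p∸half = trans (cong (_∸ half) (sym (⌊n/2⌋+⌈n/2⌉≡n p))) (m+n∸m≡n half ⌈ p /2⌉)
    ... | inj₂ odd =
      contradiction (trans (μ-orbit half<p) (cong (fold x step) p∸1+half)) (proj₁ (proj₂ (μ-partner midpoint)))
      where
      p∸1+half : p ∸ suc half ≡ half
      p∸1+half = begin
        p ∸ suc half                  ≡⟨ cong (_∸ suc half) (sym (⌊n/2⌋+⌈n/2⌉≡n p)) ⟩
        half + ⌈ p /2⌉ ∸ suc half     ≡⟨ cong (λ c → half + c ∸ suc half) odd ⟩
        half + suc half ∸ suc half    ≡⟨ m+n∸n≡m half (suc half) ⟩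
        half                          ∎

    j : Fin a
    j = proj₁ (ν̂-fixed⇒terminal midpoint-fixed)

    vs-j : vs j ≡ midpoint
    vs-j = proj₂ (ν̂-fixed⇒terminal midpoint-fixed)

    terminal-onPath : ∀ i → OnPath (vs i) → i ≡ i₀ ⊎ i ≡ j
    terminal-onPath i (zero  , _   , x≡vsi) = inj₁ (vs-injective (sym x≡vsi))
    terminal-onPath i (suc k , k<p , e) =
      inj₂ (vs-injective (trans (sym e) (trans (cong (fold x step) 1+k≡half) (sym vs-j))))
      where
      reflected : fold x step (p ∸ suc k) ≡ fold x step (suc k)
      reflected = trans (sym (ν̂-orbit (<⇒≤ k<p))) (trans (cong ν̂ e) (trans (ν̂-terminal (i , refl)) (sym e)))
      p∸1+k≡1+k : p ∸ suc k ≡ suc k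
      p∸1+k≡1+k = orbit-injective (s≤s (m∸n≤m q k)) k<p reflected
      1+k≡half : suc k ≡ half
      1+k≡half = begin
        suc k                        ≡⟨ n≡⌊n+n/2⌋ (suc k) ⟩
        ⌊ suc k + suc k /2⌋          ≡⟨ cong (λ m → ⌊ suc k + m /2⌋) (sym p∸1+k≡1+k) ⟩
        ⌊ suc k + (p ∸ suc k) /2⌋    ≡⟨ cong ⌊_/2⌋ (m+[n∸m]≡n (<⇒≤ k<p)) ⟩
        half                         ∎

    onPath-terminal : ∀ i → OnPath (vs i) ⇔ (i ≡ i₀ ⊎ i ≡ j)
    onPath-terminal i = mk⇔ (terminal-onPath i) λ where
      (inj₁ refl) → 0 , s≤s z≤n , refl
      (inj₂ refl) → half , half<p , sym vs-j

  alternatingPath : ∀ i₀ → ∃₂ λ j (S : V → Bool) → Closed S × ∀ i → S (vs i) ≡ inPair i₀ j i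
  alternatingPath i₀ = j , onPath , onPath-closed ,
    λ i → does-⇔ (onPath-terminal i) (onPath? (vs i)) ((i ≟ i₀) ⊎-dec (i ≟ j))
    where open PathFrom i₀

  combinations-matched : ∀ i₁ i₂ → ∃₂ λ j₁ j₂ →
    ∀ g → MatchRel G vs (tabulate λ k → g (inPair i₁ j₁ k) (inPair i₂ j₂ k))
  combinations-matched i₁ i₂ =
    let j₁ , S₁ , S₁-closed , S₁-trace = alternatingPath i₁
        j₂ , S₂ , S₂-closed , S₂-trace = alternatingPath i₂
    in j₁ , j₂ , λ g → subst (MatchRel G vs) (tabulate-cong λ k → cong₂ g (S₁-trace k) (S₂-trace k))
                           (closed⇒matched (closed-combine g S₁-closed S₂-closed))

pattern O = false
pattern I = true

members : List (Vec Bool 6)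
members =
  (O ∷ O ∷ O ∷ O ∷ O ∷ O ∷ []) ∷
  (I ∷ O ∷ I ∷ O ∷ O ∷ O ∷ []) ∷
  (O ∷ I ∷ I ∷ O ∷ O ∷ O ∷ []) ∷
  (O ∷ I ∷ O ∷ I ∷ O ∷ O ∷ []) ∷
  (O ∷ O ∷ I ∷ I ∷ O ∷ O ∷ []) ∷
  (I ∷ I ∷ I ∷ I ∷ O ∷ O ∷ []) ∷
  (I ∷ O ∷ O ∷ O ∷ I ∷ O ∷ []) ∷
  (O ∷ I ∷ O ∷ O ∷ I ∷ O ∷ []) ∷
  (O ∷ O ∷ I ∷ O ∷ I ∷ O ∷ []) ∷
  (I ∷ I ∷ I ∷ O ∷ I ∷ O ∷ []) ∷
  (O ∷ O ∷ O ∷ I ∷ I ∷ O ∷ []) ∷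
  (I ∷ I ∷ O ∷ I ∷ I ∷ O ∷ []) ∷
  (I ∷ O ∷ O ∷ O ∷ O ∷ I ∷ []) ∷
  (O ∷ I ∷ O ∷ O ∷ O ∷ I ∷ []) ∷
  (I ∷ I ∷ I ∷ O ∷ O ∷ I ∷ []) ∷
  (I ∷ I ∷ O ∷ I ∷ O ∷ I ∷ []) ∷
  (I ∷ O ∷ I ∷ I ∷ O ∷ I ∷ []) ∷
  (O ∷ I ∷ I ∷ I ∷ O ∷ I ∷ []) ∷
  (O ∷ O ∷ O ∷ O ∷ I ∷ I ∷ []) ∷
  (I ∷ I ∷ O ∷ O ∷ I ∷ I ∷ []) ∷
  (I ∷ O ∷ I ∷ O ∷ I ∷ I ∷ []) ∷
  (O ∷ I ∷ I ∷ O ∷ I ∷ I ∷ []) ∷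
  (I ∷ O ∷ O ∷ I ∷ I ∷ I ∷ []) ∷
  (O ∷ O ∷ I ∷ I ∷ I ∷ I ∷ []) ∷
  (I ∷ I ∷ I ∷ I ∷ I ∷ I ∷ []) ∷ []

R : Relation 6
R α = α ∈ members

R? : Decidable R
R? α = α ∈? members

Exchangeable : Vec Bool 6 → Vec Bool 6 → Set
Exchangeable α β = ∀ v → lookup α v ≢ lookup β v →
  Σ (Fin 6) λ u → lookup α u ≢ lookup β u × R (flip2 α u v)

exchangeable? : ∀ α β → Dec (Exchangeable α β)
exchangeable? α β = all? λ v → ¬? (lookup α v ≟ᵇ lookup β v) →-dec
  any? λ u → ¬? (lookup α u ≟ᵇ lookup β u) ×-dec R? (flip2 α u v)

R-isDeltaMatroid : IsDeltaMatroid R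
R-isDeltaMatroid = (_ , toWitness {a? = R? (replicate 6 false)} _) ,
  λ α β α∈R β∈R → All.lookup (All.lookup allExchangeable α∈R) β∈R
  where
  allExchangeable : All (λ α → All (Exchangeable α) members) members
  allExchangeable = toWitness {a? = All.all? (λ α → All.all? (exchangeable? α) members) members} _

R-isEven : IsEven R
R-isEven α β α∈R β∈R = trans (All.lookup allEven α∈R) (sym (All.lookup allEven β∈R))
  where
  allEven : All (λ α → ones α % 2 ≡ 0) members
  allEven = toWitness {a? = All.all? (λ α → ones α % 2 ≟ℕ 0) members} _

truthTable : Vec Bool 4 → Bool → Bool → Bool
truthTable (tt ∷ tf ∷ ft ∷ ff ∷ []) x y = if x then (if y then tt else tf) else (if y then ft else ff)

-- Opaque, or else the decision procedure is unfolded symbolically when this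
-- is applied to the (non-canonical) partners j₁, j₂ below.
opaque
  R-separatesPairs : ∀ j₁ j₂ → ∃ λ (t : Vec Bool 4) →
    ¬ R (tabulate λ k → truthTable t (inPair zero j₁ k) (inPair (suc zero) j₂ k))
  R-separatesPairs = toWitness {a? = all? λ j₁ → all? λ j₂ → anySubset? λ t → ¬? (R? _)} _

R-notMatchingRealizable : ¬ MatchingRealizable R
R-notMatchingRealizable (G , vs , vs-injective , R⇔M) =
  let j₁ , j₂ , combined = combinations-matched zero (suc zero)
      t , t∉R = R-separatesPairs j₁ j₂
  in t∉R (Equivalence.from (R⇔M _) (combined (truthTable t)))
  where
  open AlternatingPaths G vs vs-injective
    (Equivalence.to (R⇔M _) (toWitness {a? = R? (replicate 6 false)} _))
    (Equivalence.to (R⇔M _) (toWitness {a? = R? (replicate 6 true)} _))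

mainTheorem5 : Σ (Relation 6) λ R → IsEvenDeltaMatroid R × ¬ MatchingRealizable R
mainTheorem5 = R , (R-isDeltaMatroid , R-isEven) , R-notMatchingRealizable
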